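{- In every network one can find two paths from the source to the sink such that a hyperedge is traversed by both paths if, and only if, it is a cutedge.
   Context: A hypergraph has a vertex set and a multiset of nonempty vertex subsets (hyperedges; repeated copies are distinct hyperedges). A path is a sequence $(u_1,e_1,\dots,e_p,u_{p+1})$ of pairwise distinct vertices and pairwise distinct hyperedges with $u_i,u_{i+1}\in e_i$; it traverses the $e_i$. A network is a connected hypergraph with two distinct distinguished vertices, the source and the sink. A cutedge is a hyperedge traversed by every source-to-sink path. -}

module Defs where

open import Data.Nat using (ℕ; suc)
open import Data.Fin using (Fin; zero; suc; inject₁; fromℕ)
open import Data.Fin.Subset using (Subset; _∈_)
open import Data.Product using (Σ; ∃; ∃-syntax; _×_; _,_)
open import Function.Definitions using (Injective)
open import Relation.Binary.PropositionalEquality using (_≡_)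
open import Function.Bundles using (_⇔_)
import Data.Empty

-- A finite hypergraph: vertices Fin n, and m hyperedges indexed by Fin m
-- (indexing makes repeated copies distinct hyperedges), each a nonempty subset.
record Hypergraph : Set where
  field
    n        : ℕ
    m        : ℕ
    edge     : Fin m → Subset n
    nonempty : ∀ e → ∃[ v ] (v ∈ edge e)

open Hypergraph public

record Path (H : Hypergraph) (s t : Fin (n H)) : Set where
  field
    len       : ℕ
    vert      : Fin (suc len) → Fin (n H)
    hedge     : Fin len → Fin (m H)
    vertInj   : Injective _≡_ _≡_ vert
    hedgeInj  : Injective _≡_ _≡_ hedge
    incidentˡ : ∀ i → vert (inject₁ i) ∈ edge H (hedge i)
    incidentʳ : ∀ i → vert (suc i) ∈ edge H (hedge i)
    start     : vert zero ≡ s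
    end       : vert (fromℕ len) ≡ t

open Path public

Traverses : {H : Hypergraph} {s t : Fin (n H)} → Path H s t → Fin (m H) → Set
Traverses P e = ∃[ i ] (hedge P i ≡ e)

Connected : Hypergraph → Set
Connected H = ∀ (u v : Fin (n H)) → Path H u v

record Network : Set where
  field
    hyp       : Hypergraph
    connected : Connected hyp
    source    : Fin (n hyp)
    sink      : Fin (n hyp)
    distinct  : source ≡ sink → Data.Empty.⊥

Cutedge : (N : Network) → Fin (m (Network.hyp N)) → Set
Cutedge N e = ∀ (P : Path (Network.hyp N) (Network.source N) (Network.sink N)) → Traverses P e

-- Work in the bipartite incidence graph, whose nodes are the vertices and the hyperedges, and
-- call a node z unavoidable from x when every walk from x to the sink passes through z; a cutedge
-- is then a hyperedge node unavoidable from the source.  Along a walk to the sink one shows that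
-- every node x has two simple walks to the sink all of whose common nodes are unavoidable from x.
-- To pass from a node w to a neighbour x: if w is unavoidable from x, prepend x to both walks of
-- w; otherwise some walk from x avoids w, and following it until it first meets the two walks,
-- say at y on the first one, gives a detour that replaces the first walk up to y, while x is
-- prepended to the second.  Simple walks between vertices of the incidence graph are paths.

module Submission where

open import Data.Empty using (⊥-elim)
open import Data.Fin using (Fin; zero; suc; inject₁; fromℕ)
import Data.Fin.Properties as Fin
open import Data.Fin.Subset using () renaming (_∈_ to _∈ₛ_)
open import Data.Fin.Subset.Properties using () renaming (_∈?_ to _∈ₛ?_)
open import Data.List using (List; []; _∷_; length; filter; map; _++_; allFin)
open import Data.List.Properties using (filter-notAll)
open import Data.List.Membership.Propositional using (_∈_; _∉_; lose)
open import Data.List.Membership.Propositional.Properties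
  using (∈-filter⁺; ∈-map⁺; ∈-++⁺ˡ; ∈-++⁺ʳ; ∈-allFin)
open import Data.List.Relation.Binary.Subset.Propositional using (_⊆_)
open import Data.List.Relation.Unary.All as All using ([]; _∷_)
open import Data.List.Relation.Unary.AllPairs using ([]; _∷_)
open import Data.List.Relation.Unary.All.Properties using (¬Any⇒All¬; All¬⇒¬Any)
open import Data.List.Relation.Unary.Any as Any using (here; there; any?; satisfied)
open import Data.List.Relation.Unary.Unique.Propositional using (Unique)
open import Data.Nat using (ℕ; zero; suc; _≤_; z≤n; s≤s)
open import Data.Nat.Properties using (≤-trans)
open import Data.Product using (Σ; ∃; _×_; _,_)
open import Data.Sum as Sum using (_⊎_; inj₁; inj₂)
open import Data.Sum.Properties using (≡-dec)
import Data.Vec.Functional as Vector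
open import Function using (_∘_; id; flip)
open import Function.Bundles using (_⇔_; mk⇔)
open import Function.Definitions using (Injective)
open import Level using (0ℓ)
open import Relation.Binary using (Rel; Decidable; DecidableEquality; Symmetric)
open import Relation.Binary.Construct.Closure.ReflexiveTransitive using (Star; ε; _◅_; _◅◅_)
open import Relation.Binary.PropositionalEquality using (_≡_; _≢_; refl; sym; cong; subst)
open import Relation.Nullary using (Dec; yes; no; ¬?)
open import Relation.Nullary.Decidable using (_×-dec_; _⊎-dec_; map′; decidable-stable)
open import Relation.Unary as U using (Pred)

open import Defs

unique⊆⇒length≤ : ∀ {A : Set} (_≟_ : DecidableEquality A) {xs ys : List A} →
                  Unique xs → xs ⊆ ys → length xs ≤ length ys
unique⊆⇒length≤ _≟_ [] _ = z≤n
unique⊆⇒length≤ _≟_ {x ∷ xs} {ys} (x≢xs ∷ xs-unique) xs⊆ys =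
  ≤-trans (s≤s (unique⊆⇒length≤ _≟_ xs-unique xs⊆others))
          (filter-notAll (¬? ∘ (x ≟_)) ys (Any.map (λ { refl x≢x → x≢x refl }) (xs⊆ys (here refl))))
  where
  xs⊆others : xs ⊆ filter (¬? ∘ (x ≟_)) ys
  xs⊆others z∈xs = ∈-filter⁺ (¬? ∘ (x ≟_)) (xs⊆ys (there z∈xs)) (All.lookup x≢xs z∈xs)

module WalkProperties {V : Set} (_≟_ : DecidableEquality V) (Adj : Rel V 0ℓ) where

  open import Data.List.Membership.DecPropositional _≟_ using (_∈?_)

  Walk : Rel V 0ℓ
  Walk = Star Adj

  verts : ∀ {x y} → Walk x y → List V
  verts {x} ε       = x ∷ []
  verts {x} (_ ◅ W) = x ∷ verts W

  start∈verts : ∀ {x y} (W : Walk x y) → x ∈ verts W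
  start∈verts ε       = here refl
  start∈verts (_ ◅ _) = here refl

  end∈verts : ∀ {x y} (W : Walk x y) → y ∈ verts W
  end∈verts ε       = here refl
  end∈verts (_ ◅ W) = there (end∈verts W)

  ∈-verts-◅◅ : ∀ {x y z v} (W₁ : Walk x y) (W₂ : Walk y z) →
               v ∈ verts (W₁ ◅◅ W₂) → v ∈ verts W₁ ⊎ v ∈ verts W₂
  ∈-verts-◅◅ ε        W₂ v∈W₂        = inj₂ v∈W₂
  ∈-verts-◅◅ (_ ◅ W₁) W₂ (here refl) = inj₁ (here refl)
  ∈-verts-◅◅ (_ ◅ W₁) W₂ (there v∈W) = Sum.map₁ there (∈-verts-◅◅ W₁ W₂ v∈W)

  suffix : ∀ {x y z} (W : Walk x y) → z ∈ verts W → Walk z y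
  suffix ε       (here refl) = ε
  suffix (a ◅ W) (here refl) = a ◅ W
  suffix (_ ◅ W) (there z∈W) = suffix W z∈W

  suffix-⊆ : ∀ {x y z} (W : Walk x y) (z∈W : z ∈ verts W) → verts (suffix W z∈W) ⊆ verts W
  suffix-⊆ ε       (here refl) = id
  suffix-⊆ (_ ◅ W) (here refl) = id
  suffix-⊆ (_ ◅ W) (there z∈W) = there ∘ suffix-⊆ W z∈W

  suffix-unique : ∀ {x y z} (W : Walk x y) (z∈W : z ∈ verts W) →
                  Unique (verts W) → Unique (verts (suffix W z∈W))
  suffix-unique ε       (here refl) W-unique         = W-unique
  suffix-unique (_ ◅ W) (here refl) W-unique         = W-unique
  suffix-unique (_ ◅ W) (there z∈W) (_ ∷ W-unique) = suffix-unique W z∈W W-unique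

  suffix-∌-start : ∀ {x y z} (W : Walk x y) (z∈W : z ∈ verts W) →
                   Unique (verts W) → z ≢ x → x ∉ verts (suffix W z∈W)
  suffix-∌-start ε       (here refl) _ z≢x _ = z≢x refl
  suffix-∌-start (_ ◅ W) (here refl) _ z≢x _ = z≢x refl
  suffix-∌-start (_ ◅ W) (there z∈W) (x≢W ∷ _) _ x∈suffix =
    All¬⇒¬Any x≢W (suffix-⊆ W z∈W x∈suffix)

  shortcut : ∀ {x y} (W : Walk x y) → Σ (Walk x y) λ W′ → Unique (verts W′) × verts W′ ⊆ verts W
  shortcut ε = ε , ([] ∷ []) , id
  shortcut {x} (a ◅ W) with shortcut W
  ... | W′ , W′-unique , W′⊆W with x ∈? verts W′
  ...   | yes x∈W′ = suffix W′ x∈W′ , suffix-unique W′ x∈W′ W′-unique ,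
                     there ∘ W′⊆W ∘ suffix-⊆ W′ x∈W′
  ...   | no  x∉W′ = a ◅ W′ , (¬Any⇒All¬ _ x∉W′ ∷ W′-unique) ,
                     λ { (here refl) → here refl ; (there v∈W′) → there (W′⊆W v∈W′) }

  record FirstVisit (S : Pred V 0ℓ) {x y : V} (W : Walk x y) : Set where
    field
      {point}  : V
      point∈S  : S point
      prefix   : Walk x point
      prefix-⊆ : verts prefix ⊆ verts W
      first    : ∀ {z} → z ∈ verts prefix → S z → z ≡ point

  firstVisit : ∀ {S : Pred V 0ℓ} → U.Decidable S →
               ∀ {x y} (W : Walk x y) → S y → FirstVisit S W
  firstVisit S? {x} W y∈S with S? x
  firstVisit S? {x} W y∈S | yes x∈S =
    record { point∈S = x∈S ; prefix = ε ; prefix-⊆ = λ { (here refl) → start∈verts W }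
           ; first = λ { (here refl) _ → refl } }
  firstVisit S? ε y∈S | no x∉S = ⊥-elim (x∉S y∈S)
  firstVisit S? (a ◅ W) y∈S | no x∉S =
    record { point∈S = point∈S ; prefix = a ◅ prefix
           ; prefix-⊆ = λ { (here refl) → here refl ; (there v∈prefix) → there (prefix-⊆ v∈prefix) }
           ; first = λ { (here refl) x∈S → ⊥-elim (x∉S x∈S) ; (there z∈prefix) → first z∈prefix } }
    where open FirstVisit (firstVisit S? W y∈S)

module SeparatedPairs {V : Set} (_≟_ : DecidableEquality V) {Adj : Rel V 0ℓ} (adj? : Decidable Adj)
  (Adj-sym : Symmetric Adj) (vertices : List V) (∈-vertices : ∀ v → v ∈ vertices) (sink : V) where

  open WalkProperties _≟_ Adj
  open import Data.List.Membership.DecPropositional _≟_ using (_∈?_)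

  Unavoidable : V → V → Set
  Unavoidable x z = (W : Walk x sink) → z ∈ verts W

  unavoidable-start : ∀ {x} → Unavoidable x x
  unavoidable-start = start∈verts

  unavoidable-trans : ∀ {x w z} → Unavoidable x w → Unavoidable w z → Unavoidable x z
  unavoidable-trans x⇝w w⇝z W = suffix-⊆ W (x⇝w W) (w⇝z (suffix W (x⇝w W)))

  unavoidable-◅ : ∀ {x w z} → Adj x w → Unavoidable w z → z ≢ w → Unavoidable x z
  unavoidable-◅ a w⇝z z≢w W with w⇝z (Adj-sym a ◅ W)
  ... | here z≡w  = ⊥-elim (z≢w z≡w)
  ... | there z∈W = z∈W

  Avoiding : V → V → Set
  Avoiding w x = Σ (Walk x sink) λ W → w ∉ verts W

  AvoidingWithin : ℕ → V → V → Set
  AvoidingWithin k w x = Σ (Walk x sink) λ W → w ∉ verts W × length (verts W) ≤ k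

  avoidingWithin? : ∀ k w x → Dec (AvoidingWithin k w x)
  avoidingWithin? zero w x = no λ { (ε , _ , ()) ; (_ ◅ _ , _ , ()) }
  avoidingWithin? (suc k) w x with w ≟ x | x ≟ sink
  ... | yes refl | _        = no λ (W , w∉W , _) → w∉W (start∈verts W)
  ... | no w≢x   | yes refl = yes (ε , (λ { (here w≡x) → w≢x w≡x }) , s≤s z≤n)
  ... | no w≢x   | no x≢sink with any? (λ u → adj? x u ×-dec avoidingWithin? k w u) vertices
  ...   | yes found = let (u , a , W , w∉W , W≤k) = satisfied found in
                      yes (a ◅ W , (λ { (here w≡x) → w≢x w≡x ; (there w∈W) → w∉W w∈W }) , s≤s W≤k)
  ...   | no none   = no λ
    { (ε , _) → x≢sink refl
    ; (a ◅ W , w∉aW , s≤s W≤k) → none (lose (∈-vertices _) (a , W , w∉aW ∘ there , W≤k)) }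

  -- The bound loses nothing: shortcutting makes a walk simple, and a simple walk is no longer
  -- than the enumeration of all vertices.
  avoiding? : ∀ w x → Dec (Avoiding w x)
  avoiding? w x = map′ (λ (W , w∉W , _) → W , w∉W) shorten (avoidingWithin? (length vertices) w x)
    where
    shorten : Avoiding w x → AvoidingWithin (length vertices) w x
    shorten (W , w∉W) with shortcut W
    ... | W′ , W′-unique , W′⊆W =
      W′ , w∉W ∘ W′⊆W , unique⊆⇒length≤ _≟_ W′-unique (λ {v} _ → ∈-vertices v)

  unavoidable⊎avoiding : ∀ w x → Unavoidable x w ⊎ Avoiding w x
  unavoidable⊎avoiding w x with avoiding? w x
  ... | yes avoiding = inj₂ avoiding
  ... | no ¬avoiding = inj₁ λ W → decidable-stable (w ∈? verts W) (λ w∉W → ¬avoiding (W , w∉W))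

  SharedUnavoidable : ∀ {x} → Walk x sink → Walk x sink → Set
  SharedUnavoidable {x} P Q = ∀ {z} → z ∈ verts P → z ∈ verts Q → Unavoidable x z

  record SeparatedPair (x : V) : Set where
    field
      left          : Walk x sink
      right         : Walk x sink
      left-unique   : Unique (verts left)
      right-unique  : Unique (verts right)
      shared⇒unavoidable : SharedUnavoidable left right

  open SeparatedPair

  swap : ∀ {x} → SeparatedPair x → SeparatedPair x
  swap π = record
    { left = right π ; right = left π ; left-unique = right-unique π ; right-unique = left-unique π
    ; shared⇒unavoidable = flip (shared⇒unavoidable π) }

  separatedPair-shortcut : ∀ {x} (P Q : Walk x sink) → SharedUnavoidable P Q → SeparatedPair x
  separatedPair-shortcut P Q shared with shortcut P | shortcut Q
  ... | P′ , P′-unique , P′⊆P | Q′ , Q′-unique , Q′⊆Q = record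
    { left = P′ ; right = Q′ ; left-unique = P′-unique ; right-unique = Q′-unique
    ; shared⇒unavoidable = λ z∈P′ z∈Q′ → shared (P′⊆P z∈P′) (Q′⊆Q z∈Q′) }

  extend-unavoidable : ∀ {x w} → Adj x w → Unavoidable x w → SeparatedPair w → SeparatedPair x
  extend-unavoidable {x} a x⇝w π = separatedPair-shortcut (a ◅ left π) (a ◅ right π) shared
    where
    shared : SharedUnavoidable (a ◅ left π) (a ◅ right π)
    shared (here refl) _           = unavoidable-start
    shared (there _)   (here refl) = unavoidable-start
    shared (there z∈P) (there z∈Q) = unavoidable-trans x⇝w (shared⇒unavoidable π z∈P z∈Q)

  OnPair : ∀ {w} → SeparatedPair w → Pred V 0ℓ
  OnPair π z = z ∈ verts (left π) ⊎ z ∈ verts (right π)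

  -- A node shared by the new walks is x, or y, or a node other than w shared by left and right.
  extend-detour-left : ∀ {x w} → Adj x w → (π : SeparatedPair w) →
                       ∀ {y} → y ∈ verts (left π) → (R₁ : Walk x y) → w ∉ verts R₁ →
                       (∀ {z} → z ∈ verts R₁ → OnPair π z → z ≡ y) → SeparatedPair x
  extend-detour-left {x} {w} a π {y} y∈P R₁ w∉R₁ R₁-first =
    separatedPair-shortcut (R₁ ◅◅ P₂) (a ◅ right π) shared
    where
    P₂ = suffix (left π) y∈P
    y≢w : y ≢ w
    y≢w refl = w∉R₁ (end∈verts R₁)
    shared : SharedUnavoidable (R₁ ◅◅ P₂) (a ◅ right π)
    shared _ (here refl) = unavoidable-start
    shared z∈R₁P₂ (there z∈Q) with ∈-verts-◅◅ R₁ P₂ z∈R₁P₂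
    ... | inj₁ z∈R₁ with R₁-first z∈R₁ (inj₂ z∈Q)
    ...   | refl = unavoidable-◅ a (shared⇒unavoidable π y∈P z∈Q) y≢w
    shared _ (there z∈Q) | inj₂ z∈P₂ =
      unavoidable-◅ a (shared⇒unavoidable π (suffix-⊆ (left π) y∈P z∈P₂) z∈Q)
        λ { refl → suffix-∌-start (left π) y∈P (left-unique π) y≢w z∈P₂ }

  extend-avoiding : ∀ {x w} → Adj x w → Avoiding w x → SeparatedPair w → SeparatedPair x
  extend-avoiding a (R , w∉R) π
    with firstVisit (λ z → (z ∈? verts (left π)) ⊎-dec (z ∈? verts (right π))) R
                    (inj₁ (end∈verts (left π)))
  ... | record { point∈S = inj₁ y∈P ; prefix = R₁ ; prefix-⊆ = R₁⊆R ; first = R₁-first } =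
    extend-detour-left a π y∈P R₁ (w∉R ∘ R₁⊆R) R₁-first
  ... | record { point∈S = inj₂ y∈Q ; prefix = R₁ ; prefix-⊆ = R₁⊆R ; first = R₁-first } =
    extend-detour-left a (swap π) y∈Q R₁ (w∉R ∘ R₁⊆R) (λ z∈R₁ → R₁-first z∈R₁ ∘ Sum.swap)

  separatedPair : ∀ {x} → Walk x sink → SeparatedPair x
  separatedPair ε = record
    { left = ε ; right = ε ; left-unique = [] ∷ [] ; right-unique = [] ∷ []
    ; shared⇒unavoidable = λ { (here refl) _ → unavoidable-start } }
  separatedPair {x} (_◅_ {j = w} a W) with unavoidable⊎avoiding w x
  ... | inj₁ x⇝w     = extend-unavoidable a x⇝w (separatedPair W)
  ... | inj₂ avoiding = extend-avoiding a avoiding (separatedPair W)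

module IncidenceGraph (H : Hypergraph) where

  Node : Set
  Node = Fin (n H) ⊎ Fin (m H)

  _≟_ : DecidableEquality Node
  _≟_ = ≡-dec Fin._≟_ Fin._≟_

  data Incident : Rel Node 0ℓ where
    vertex→edge : ∀ {v e} → v ∈ₛ edge H e → Incident (inj₁ v) (inj₂ e)
    edge→vertex : ∀ {v e} → v ∈ₛ edge H e → Incident (inj₂ e) (inj₁ v)

  incident? : Decidable Incident
  incident? (inj₁ v) (inj₂ e) = map′ vertex→edge (λ { (vertex→edge v∈e) → v∈e }) (v ∈ₛ? edge H e)
  incident? (inj₂ e) (inj₁ v) = map′ edge→vertex (λ { (edge→vertex v∈e) → v∈e }) (v ∈ₛ? edge H e)
  incident? (inj₁ _) (inj₁ _) = no λ ()
  incident? (inj₂ _) (inj₂ _) = no λ ()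

  incident-sym : Symmetric Incident
  incident-sym (vertex→edge v∈e) = edge→vertex v∈e
  incident-sym (edge→vertex v∈e) = vertex→edge v∈e

  nodes : List Node
  nodes = map inj₁ (allFin (n H)) ++ map inj₂ (allFin (m H))

  ∈-nodes : ∀ x → x ∈ nodes
  ∈-nodes (inj₁ v) = ∈-++⁺ˡ (∈-map⁺ inj₁ (∈-allFin v))
  ∈-nodes (inj₂ e) = ∈-++⁺ʳ (map inj₁ (allFin (n H))) (∈-map⁺ inj₂ (∈-allFin e))

  module Sink (t : Fin (n H)) =
    SeparatedPairs _≟_ incident? incident-sym nodes ∈-nodes (inj₁ t)

  open WalkProperties _≟_ Incident

  walkAlong : ∀ {a b} ℓ (vt : Fin (suc ℓ) → Fin (n H)) (hd : Fin ℓ → Fin (m H)) →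
              (∀ i → vt (inject₁ i) ∈ₛ edge H (hd i)) → (∀ i → vt (suc i) ∈ₛ edge H (hd i)) →
              vt zero ≡ a → vt (fromℕ ℓ) ≡ b → Walk (inj₁ a) (inj₁ b)
  walkAlong zero    vt hd incˡ incʳ refl refl = ε
  walkAlong (suc ℓ) vt hd incˡ incʳ refl end =
    vertex→edge (incˡ zero) ◅ edge→vertex (incʳ zero) ◅
      walkAlong ℓ (vt ∘ suc) (hd ∘ suc) (incˡ ∘ suc) (incʳ ∘ suc) refl end

  walkAlong-edges : ∀ {a b} ℓ vt hd incˡ incʳ (start : vt zero ≡ a) (end : vt (fromℕ ℓ) ≡ b) {e} →
                    inj₂ e ∈ verts (walkAlong ℓ vt hd incˡ incʳ start end) → ∃ λ i → hd i ≡ e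
  walkAlong-edges zero    vt hd incˡ incʳ refl refl (here ())
  walkAlong-edges (suc ℓ) vt hd incˡ incʳ refl end (there (here refl)) = zero , refl
  walkAlong-edges (suc ℓ) vt hd incˡ incʳ refl end (there (there e∈W)) =
    let i , hd[i]≡e = walkAlong-edges ℓ (vt ∘ suc) (hd ∘ suc) (incˡ ∘ suc) (incʳ ∘ suc) refl end e∈W
    in suc i , hd[i]≡e

  pathToWalk : ∀ {a b} → Path H a b → Walk (inj₁ a) (inj₁ b)
  pathToWalk P = walkAlong (len P) (vert P) (hedge P) (incidentˡ P) (incidentʳ P) (start P) (end P)

  pathToWalk-traverses : ∀ {a b} (P : Path H a b) {e} → inj₂ e ∈ verts (pathToWalk P) → Traverses P e
  pathToWalk-traverses P =
    walkAlong-edges (len P) (vert P) (hedge P) (incidentˡ P) (incidentʳ P) (start P) (end P)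

  trivialPath : ∀ a → Path H a a
  trivialPath a = record
    { len = zero ; vert = λ _ → a ; hedge = λ () ; vertInj = λ { {zero} {zero} _ → refl }
    ; hedgeInj = λ { {()} } ; incidentˡ = λ () ; incidentʳ = λ () ; start = refl ; end = refl }

  ∷-injective : ∀ {A : Set} {ℓ} {x : A} {f : Fin ℓ → A} →
                (∀ i → f i ≢ x) → Injective _≡_ _≡_ f → Injective _≡_ _≡_ (x Vector.∷ f)
  ∷-injective fresh f-inj {zero}  {zero}  _   = refl
  ∷-injective fresh f-inj {zero}  {suc j} x≡f = ⊥-elim (fresh j (sym x≡f))
  ∷-injective fresh f-inj {suc i} {zero}  f≡x = ⊥-elim (fresh i f≡x)
  ∷-injective fresh f-inj {suc i} {suc j} f≡f = cong suc (f-inj f≡f)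

  consPath : ∀ {a v b e} → a ∈ₛ edge H e → v ∈ₛ edge H e → (P : Path H v b) →
             (∀ i → vert P i ≢ a) → (∀ i → hedge P i ≢ e) → Path H a b
  consPath {a} {e = e} a∈e v∈e P a-fresh e-fresh = record
    { len = suc (len P) ; vert = a Vector.∷ vert P ; hedge = e Vector.∷ hedge P
    ; vertInj = ∷-injective a-fresh (vertInj P) ; hedgeInj = ∷-injective e-fresh (hedgeInj P)
    ; incidentˡ = λ { zero → a∈e ; (suc i) → incidentˡ P i }
    ; incidentʳ = λ { zero → subst (_∈ₛ edge H e) (sym (start P)) v∈e ; (suc i) → incidentʳ P i }
    ; start = refl ; end = end P }

  walkToPath : ∀ {a b} (W : Walk (inj₁ a) (inj₁ b)) → Unique (verts W) → Path H a b
  walkToPath-vert : ∀ {a b} (W : Walk (inj₁ a) (inj₁ b)) (W-unique : Unique (verts W)) i →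
                    inj₁ (vert (walkToPath W W-unique) i) ∈ verts W
  walkToPath-hedge : ∀ {a b} (W : Walk (inj₁ a) (inj₁ b)) (W-unique : Unique (verts W)) i →
                     inj₂ (hedge (walkToPath W W-unique) i) ∈ verts W

  walkToPath ε _ = trivialPath _
  walkToPath (vertex→edge a∈e ◅ edge→vertex v∈e ◅ W) (a-fresh ∷ e-fresh ∷ W-unique) =
    consPath a∈e v∈e (walkToPath W W-unique)
      (λ i eq → All.lookup a-fresh (there (walkToPath-vert W W-unique i)) (cong inj₁ (sym eq)))
      (λ i eq → All.lookup e-fresh (walkToPath-hedge W W-unique i) (cong inj₂ (sym eq)))

  walkToPath-vert ε _ zero = here refl
  walkToPath-vert (vertex→edge _ ◅ edge→vertex _ ◅ _) (_ ∷ _ ∷ _) zero = here refl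
  walkToPath-vert (vertex→edge _ ◅ edge→vertex _ ◅ W) (_ ∷ _ ∷ W-unique) (suc i) =
    there (there (walkToPath-vert W W-unique i))

  walkToPath-hedge (vertex→edge _ ◅ edge→vertex _ ◅ _) (_ ∷ _ ∷ _) zero = there (here refl)
  walkToPath-hedge (vertex→edge _ ◅ edge→vertex _ ◅ W) (_ ∷ _ ∷ W-unique) (suc i) =
    there (there (walkToPath-hedge W W-unique i))

  walkToPath-traverses : ∀ {a b} (W : Walk (inj₁ a) (inj₁ b)) (W-unique : Unique (verts W)) {e} →
                         Traverses (walkToPath W W-unique) e → inj₂ e ∈ verts W
  walkToPath-traverses W W-unique (i , refl) = walkToPath-hedge W W-unique i

mainTheorem11 : (N : Network) →
    Σ (Path (Network.hyp N) (Network.source N) (Network.sink N)) λ P →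
    Σ (Path (Network.hyp N) (Network.source N) (Network.sink N)) λ Q →
      ∀ (e : Fin (m (Network.hyp N))) →
        ((Traverses P e × Traverses Q e) ⇔ Cutedge N e)
mainTheorem11 N = P , Q , λ e → mk⇔
  (λ (e∈P , e∈Q) R → pathToWalk-traverses R
     (shared⇒unavoidable (walkToPath-traverses left left-unique e∈P)
                         (walkToPath-traverses right right-unique e∈Q) (pathToWalk R)))
  (λ cut → cut P , cut Q)
  where
  open Network N
  open IncidenceGraph hyp
  open Sink sink using (separatedPair; module SeparatedPair)
  open SeparatedPair (separatedPair (pathToWalk (connected source sink)))
  P Q : Path hyp source sink
  P = walkToPath left left-unique
  Q = walkToPath right right-unique
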